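{- Every finite connected simple graph $\Sigma$ with more than one vertex is isomorphic to a monodromy graph $\mathrm{Mon}(G;U,\rho,\tau)$ for some group $G=\langle\rho,\tau\rangle$ with $\tau^2=1$ and some core-free subgroup $U$ of $G$.
   Context: A subgroup $U\le G$ is core-free if $\bigcap_{g\in G}g^{ -1}Ug=1$. Monodromy graph: for $G=\langle\rho,\tau\rangle$ with $\tau^2=1$, $U$ core-free, $H=\langle\rho\rangle$, and $S$ a right transversal of $U$ in $G$, $\mathrm{Mon}(G;U,\rho,\tau)$ has vertex set $\{UgH\mid g\in G\}$, edge set $\{\{UhH,Uh\tau H\}\mid h\in S\}$, and for $h\in S$ the multiplicity of the edge between $UhH$ and $Uh\tau H$ is $|D|$ where $D=\{g\in S\mid g\in UhH \text{ and } g\tau\in Uh\tau H\}$; the edge is a free edge (only one end at a vertex) if $h\tau\in Uh$ and a loop if $h\tau\notin Uh$ but $h\tau\in UhH$. -}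

module Defs where

open import Level using (Level; 0ℓ; _⊔_) renaming (suc to lsuc)
open import Algebra.Bundles using (Group)
open import Data.Nat using (ℕ; zero; suc; _<_)
open import Data.Integer using (ℤ; +_; -[1+_])
open import Data.Fin using (Fin)
open import Data.Bool using (Bool; true; false)
open import Data.Product using (Σ; ∃; ∃₂; _×_; _,_)
open import Relation.Binary.PropositionalEquality using (_≡_; _≢_)
open import Relation.Nullary using (¬_)

record SimpleGraph (n : ℕ) : Set where
  field
    Adj       : Fin n → Fin n → Bool
    symmetric : ∀ x y → Adj x y ≡ Adj y x
    loopless  : ∀ x → Adj x x ≡ false

module _ {n : ℕ} (Γ : SimpleGraph n) where
  open SimpleGraph Γ

  data Walk : Fin n → Fin n → Set where
    nil  : ∀ {x} → Walk x x
    cons : ∀ {x y z} → Adj x y ≡ true → Walk y z → Walk x z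

  Connected : Set
  Connected = ∀ x y → Walk x y

module GroupNotions {c ℓ : Level} (G : Group c ℓ) where
  open Group G

  _^ℕ_ : Carrier → ℕ → Carrier
  g ^ℕ zero  = ε
  g ^ℕ suc k = g ∙ (g ^ℕ k)

  _^ℤ_ : Carrier → ℤ → Carrier
  g ^ℤ (+ k)      = g ^ℕ k
  g ^ℤ (-[1+ k ]) = (g ^ℕ suc k) ⁻¹

  record IsSubgroup {p : Level} (U : Carrier → Set p) : Set (c ⊔ ℓ ⊔ p) where
    field
      resp : ∀ {x y} → x ≈ y → U x → U y
      ε∈   : U ε
      ∙∈   : ∀ {x y} → U x → U y → U (x ∙ y)
      ⁻¹∈  : ∀ {x} → U x → U (x ⁻¹)

  -- core-free: ⋂_{g ∈ G} g⁻¹ U g = 1   (x ∈ g⁻¹Ug  iff  g x g⁻¹ ∈ U)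
  CoreFree : {p : Level} → (Carrier → Set p) → Set (c ⊔ ℓ ⊔ p)
  CoreFree U = ∀ x → (∀ g → U ((g ∙ x) ∙ (g ⁻¹))) → x ≈ ε

  data InGen (ρ τ : Carrier) : Carrier → Set (c ⊔ ℓ) where
    gen-ε   : InGen ρ τ ε
    gen-ρ   : ∀ {g} → InGen ρ τ g → InGen ρ τ (g ∙ ρ)
    gen-ρ⁻¹ : ∀ {g} → InGen ρ τ g → InGen ρ τ (g ∙ (ρ ⁻¹))
    gen-τ   : ∀ {g} → InGen ρ τ g → InGen ρ τ (g ∙ τ)
    gen-τ⁻¹ : ∀ {g} → InGen ρ τ g → InGen ρ τ (g ∙ (τ ⁻¹))
    gen-≈   : ∀ {g h} → g ≈ h → InGen ρ τ g → InGen ρ τ h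

  Generates : Carrier → Carrier → Set (c ⊔ ℓ)
  Generates ρ τ = ∀ g → InGen ρ τ g

  module _ {p : Level} (U : Carrier → Set p) (ρ : Carrier) where
    -- g' ∈ U g H, where H = ⟨ρ⟩   (i.e. U g' H = U g H)
    InDC : Carrier → Carrier → Set (c ⊔ ℓ ⊔ p)
    InDC g g' = Σ Carrier λ u → Σ ℤ λ k → U u × (g' ≈ (u ∙ g) ∙ (ρ ^ℤ k))

    InRC : Carrier → Carrier → Set p
    InRC g g' = U (g' ∙ (g ⁻¹))

    CosetCount : {q : Level} → (Carrier → Set q) → ℕ → Set (c ⊔ p ⊔ q)
    CosetCount P k =
      Σ (Fin k → Carrier) λ f →
        (∀ i → P (f i)) ×
        (∀ i j → InRC (f i) (f j) → i ≡ j) ×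
        (∀ g → P g → Σ (Fin k) λ i → InRC (f i) g)

    -- multiplicity |D| of the edge {U a H, U b H} of Mon(G;U,ρ,τ):
    -- the number of transversal elements g (equivalently right cosets U g)
    -- with g ∈ U a H and g τ ∈ U b H
    EdgeMultiplicity : Carrier → Carrier → Carrier → ℕ → Set (c ⊔ ℓ ⊔ p)
    EdgeMultiplicity τ a b k = CosetCount (λ g → InDC a g × InDC b (g ∙ τ)) k

  -- Vertices of Mon are the double cosets U g H; every g (in particular
  -- every transversal element h) gives the edge {U g H, U g τ H}, which is a
  -- free edge or a loop exactly when g τ ∈ U g H.
  record MonIso {n : ℕ} (Γ : SimpleGraph n) {p : Level}
                (U : Carrier → Set p) (ρ τ : Carrier) : Set (c ⊔ ℓ ⊔ p) where
    open SimpleGraph Γ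
    field
      -- vertex bijection  Fin n ≅ { U g H }   (via representatives φ x)
      φ          : Fin n → Carrier
      φ-onto     : ∀ g → Σ (Fin n) λ x → InDC U ρ (φ x) g
      φ-injective : ∀ x y → InDC U ρ (φ x) (φ y) → x ≡ y
      -- Γ is simple: Mon has no free edges and no loops
      no-free-edge-or-loop : ∀ g → ¬ InDC U ρ g (g ∙ τ)
      edges-adj    : ∀ x y → x ≢ y → Adj x y ≡ true →
                     EdgeMultiplicity U ρ τ (φ x) (φ y) 1
      edges-nonadj : ∀ x y → x ≢ y → Adj x y ≡ false →
                     EdgeMultiplicity U ρ τ (φ x) (φ y) 0

record MonodromyRealisation {n : ℕ} (Γ : SimpleGraph n) : Set₁ where
  field
    G : Group 0ℓ 0ℓ
  open Group G
  open GroupNotions G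
  field
    ρ τ        : Carrier
    U          : Carrier → Set
    generates  : Generates ρ τ
    τ-involution : τ ∙ τ ≈ ε
    U-subgroup : IsSubgroup U
    U-corefree : CoreFree U
    iso        : MonIso Γ U ρ τ

-- Let G be the permutation group of the darts (directed edges) of Σ generated by ρ, which
-- rotates the darts cyclically around their origin, and the involution τ, which reverses each
-- dart; U is the stabiliser of a base dart. Connectivity makes G transitive on darts, so the
-- right cosets U g are the darts, U is core-free, and U g ⟨ρ⟩ is determined by the origin of
-- the dart, i.e. is a vertex. For adjacent x, y the only coset U g with g ∈ U φx H and
-- g τ ∈ U φy H is the dart from x to y; since Σ is loopless, g τ never lies in U g H.

module Submission where

open import Level using (0ℓ)
open import Algebra.Bundles using (Group)
open import Algebra.Structures using (IsGroup)
open import Data.Bool using (Bool; true; false; if_then_else_)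
open import Data.Empty using (⊥-elim)
open import Data.Fin using (Fin; zero; suc; toℕ)
open import Data.Fin.Properties using (toℕ-injective; toℕ-fromℕ<; toℕ<n; suc-injective)
open import Data.Integer using (+_; -[1+_])
open import Data.List using (List; []; _∷_; _++_; [_]; foldl)
open import Data.List.Properties using (foldl-++; ++-assoc; ++-identityʳ)
open import Data.Nat using (ℕ; zero; suc; _+_; _∸_; _%_; _<_; s≤s; NonZero)
open import Data.Nat.DivMod using (_mod_; %-distribˡ-+; m%n%n≡m%n; [m+n]%n≡m%n; m<n⇒m%n≡m)
open import Data.Nat.GeneralisedArithmetic using (fold; iterate; iterate-is-fold)
open import Data.Nat.Properties using (+-suc; +-comm; +-assoc; +-identityʳ; m+[n∸m]≡n; <⇒≤)
open import Data.Product using (Σ; ∃; _,_; proj₁; proj₂; _×_)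
open import Function using (id; _∘_)
open import Relation.Nullary using (¬_)
open import Relation.Binary.PropositionalEquality using (_≡_; refl; sym; trans; cong; cong₂; module ≡-Reasoning)
open import Defs

[m%d+n]%d≡[m+n]%d : ∀ m n d .{{_ : NonZero d}} → (m % d + n) % d ≡ (m + n) % d
[m%d+n]%d≡[m+n]%d m n d = begin
  (m % d + n) % d          ≡⟨ %-distribˡ-+ (m % d) n d ⟩
  (m % d % d + n % d) % d  ≡⟨ cong (λ k → (k + n % d) % d) (m%n%n≡m%n m d) ⟩
  (m % d + n % d) % d      ≡⟨ %-distribˡ-+ m n d ⟨
  (m + n) % d              ∎
  where open ≡-Reasoning

rotate : ∀ {d} → Fin d → Fin d
rotate {suc m} i = suc (toℕ i) mod suc m

toℕ-rotate : ∀ {m} (i : Fin (suc m)) → toℕ (rotate i) ≡ suc (toℕ i) % suc m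
toℕ-rotate i = toℕ-fromℕ< _

toℕ-iterate-rotate : ∀ {m} (i : Fin (suc m)) k → toℕ (iterate rotate i k) ≡ (toℕ i + k) % suc m
toℕ-iterate-rotate {m} i zero = begin
  toℕ i               ≡⟨ m<n⇒m%n≡m (toℕ<n i) ⟨
  toℕ i % suc m       ≡⟨ cong (_% suc m) (+-identityʳ (toℕ i)) ⟨
  (toℕ i + 0) % suc m ∎
  where open ≡-Reasoning
toℕ-iterate-rotate {m} i (suc k) = begin
  toℕ (iterate rotate (rotate i) k)  ≡⟨ toℕ-iterate-rotate (rotate i) k ⟩
  (toℕ (rotate i) + k) % suc m       ≡⟨ cong (λ j → (j + k) % suc m) (toℕ-rotate i) ⟩
  (suc (toℕ i) % suc m + k) % suc m  ≡⟨ [m%d+n]%d≡[m+n]%d (suc (toℕ i)) k (suc m) ⟩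
  (suc (toℕ i) + k) % suc m          ≡⟨ cong (_% suc m) (+-suc (toℕ i) k) ⟨
  (toℕ i + suc k) % suc m            ∎
  where open ≡-Reasoning

iterate-rotate-reaches : ∀ {d} (i j : Fin d) → ∃ λ k → iterate rotate i k ≡ j
iterate-rotate-reaches {suc m} i j = k , toℕ-injective (begin
  toℕ (iterate rotate i k)         ≡⟨ toℕ-iterate-rotate i k ⟩
  (toℕ i + k) % suc m              ≡⟨ cong (_% suc m) (+-assoc (toℕ i) (suc m ∸ toℕ i) (toℕ j)) ⟨
  (toℕ i + (suc m ∸ toℕ i) + toℕ j) % suc m
                                   ≡⟨ cong (λ l → (l + toℕ j) % suc m) (m+[n∸m]≡n (<⇒≤ (toℕ<n i))) ⟩
  (suc m + toℕ j) % suc m          ≡⟨ cong (_% suc m) (+-comm (suc m) (toℕ j)) ⟩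
  (toℕ j + suc m) % suc m          ≡⟨ [m+n]%n≡m%n (toℕ j) (suc m) ⟩
  toℕ j % suc m                    ≡⟨ m<n⇒m%n≡m (toℕ<n j) ⟩
  toℕ j                            ∎)
  where
  open ≡-Reasoning
  k = (suc m ∸ toℕ i) + toℕ j

iterate-rotate-period : ∀ {m} (i : Fin (suc m)) → iterate rotate i (suc m) ≡ i
iterate-rotate-period {m} i = toℕ-injective (begin
  toℕ (iterate rotate i (suc m))  ≡⟨ toℕ-iterate-rotate i (suc m) ⟩
  (toℕ i + suc m) % suc m         ≡⟨ [m+n]%n≡m%n (toℕ i) (suc m) ⟩
  toℕ i % suc m                   ≡⟨ m<n⇒m%n≡m (toℕ<n i) ⟩
  toℕ i                           ∎)
  where open ≡-Reasoning

rotate⁻¹ : ∀ {d} → Fin d → Fin d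
rotate⁻¹ {suc m} i = iterate rotate i m

rotate⁻¹-rotate : ∀ {d} (i : Fin d) → rotate⁻¹ (rotate i) ≡ i
rotate⁻¹-rotate {suc m} = iterate-rotate-period

rotate-rotate⁻¹ : ∀ {d} (i : Fin d) → rotate (rotate⁻¹ i) ≡ i
rotate-rotate⁻¹ {suc m} i = begin
  rotate (iterate rotate i m)  ≡⟨ cong rotate (iterate-is-fold i rotate m) ⟨
  fold i rotate (suc m)        ≡⟨ iterate-is-fold i rotate (suc m) ⟩
  iterate rotate i (suc m)     ≡⟨ iterate-rotate-period i ⟩
  i                            ∎
  where open ≡-Reasoning

private variable n : ℕ

count : (Fin n → Bool) → ℕ
count {zero}  P = 0
count {suc n} P = (if P zero then suc else id) (count (P ∘ suc))

select : (P : Fin n → Bool) → Fin (count P) → Fin n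
select {suc n} P i with P zero
select {suc n} P zero    | true  = zero
select {suc n} P (suc i) | true  = suc (select (P ∘ suc) i)
select {suc n} P i       | false = suc (select (P ∘ suc) i)

index : (P : Fin n → Bool) (y : Fin n) → P y ≡ true → Fin (count P)
index {suc n} P zero p with P zero
index {suc n} P zero p  | true  = zero
index {suc n} P zero () | false
index {suc n} P (suc y) p with P zero
... | true  = suc (index (P ∘ suc) y p)
... | false = index (P ∘ suc) y p

select-true : (P : Fin n → Bool) (i : Fin (count P)) → P (select P i) ≡ true
select-true {suc n} P i with P zero in eq
select-true {suc n} P zero    | true  = eq
select-true {suc n} P (suc i) | true  = select-true (P ∘ suc) i
select-true {suc n} P i       | false = select-true (P ∘ suc) i

select-index : (P : Fin n → Bool) (y : Fin n) (p : P y ≡ true) → select P (index P y p) ≡ y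
select-index {suc n} P zero p with P zero
select-index {suc n} P zero p  | true  = refl
select-index {suc n} P zero () | false
select-index {suc n} P (suc y) p with P zero
... | true  = cong suc (select-index (P ∘ suc) y p)
... | false = cong suc (select-index (P ∘ suc) y p)

index-select : (P : Fin n → Bool) (i : Fin (count P)) (y : Fin n) (p : P y ≡ true) →
               select P i ≡ y → index P y p ≡ i
index-select {suc n} P i zero p e with P zero
index-select {suc n} P zero    zero p  e  | true  = refl
index-select {suc n} P (suc i) zero p  () | true
index-select {suc n} P i       zero () e  | false
index-select {suc n} P i (suc y) p e with P zero
index-select {suc n} P zero    (suc y) p () | true
index-select {suc n} P (suc i) (suc y) p e  | true  = cong suc (index-select (P ∘ suc) i y p (suc-injective e))
index-select {suc n} P i       (suc y) p e  | false = index-select (P ∘ suc) i y p (suc-injective e)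

module WordAction {Ω L : Set} (⟦_⟧ : L → Ω → Ω) (_⁻ : L → L)
                  (⟦⁻⟧∘⟦⟧ : ∀ a ω → ⟦ a ⁻ ⟧ (⟦ a ⟧ ω) ≡ ω)
                  (⟦⟧∘⟦⁻⟧ : ∀ a ω → ⟦ a ⟧ (⟦ a ⁻ ⟧ ω) ≡ ω) where

  act : List L → Ω → Ω
  act w ω = foldl (λ ω′ a → ⟦ a ⟧ ω′) ω w

  act-++ : ∀ v w ω → act (v ++ w) ω ≡ act w (act v ω)
  act-++ v w ω = foldl-++ _ ω v w

  invert : List L → List L
  invert []      = []
  invert (a ∷ w) = invert w ++ [ a ⁻ ]

  act-invertˡ : ∀ w ω → act (invert w) (act w ω) ≡ ω
  act-invertˡ []      ω = refl
  act-invertˡ (a ∷ w) ω = begin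
    act (invert w ++ [ a ⁻ ]) (act w (⟦ a ⟧ ω))  ≡⟨ act-++ (invert w) [ a ⁻ ] _ ⟩
    ⟦ a ⁻ ⟧ (act (invert w) (act w (⟦ a ⟧ ω)))    ≡⟨ cong ⟦ a ⁻ ⟧ (act-invertˡ w (⟦ a ⟧ ω)) ⟩
    ⟦ a ⁻ ⟧ (⟦ a ⟧ ω)                            ≡⟨ ⟦⁻⟧∘⟦⟧ a ω ⟩
    ω                                            ∎
    where open ≡-Reasoning

  act-invertʳ : ∀ w ω → act w (act (invert w) ω) ≡ ω
  act-invertʳ []      ω = refl
  act-invertʳ (a ∷ w) ω = begin
    act w (⟦ a ⟧ (act (invert w ++ [ a ⁻ ]) ω))  ≡⟨ cong (act w ∘ ⟦ a ⟧) (act-++ (invert w) [ a ⁻ ] ω) ⟩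
    act w (⟦ a ⟧ (⟦ a ⁻ ⟧ (act (invert w) ω)))    ≡⟨ cong (act w) (⟦⟧∘⟦⁻⟧ a _) ⟩
    act w (act (invert w) ω)                     ≡⟨ act-invertʳ w ω ⟩
    ω                                            ∎
    where open ≡-Reasoning

  act-invert-invariant : ∀ {A : Set} (f : Ω → A) w →
                         (∀ ω → f (act w ω) ≡ f ω) → ∀ ω → f (act (invert w) ω) ≡ f ω
  act-invert-invariant f w f-invariant ω =
    trans (sym (f-invariant (act (invert w) ω))) (cong f (act-invertʳ w ω))

  -- Words are identified when they act alike, so the group is the permutation
  -- group of Ω generated by the letters.
  _≈_ : List L → List L → Set
  v ≈ w = ∀ ω → act v ω ≡ act w ω

  ≡⇒≈ : ∀ {v w} → v ≡ w → v ≈ w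
  ≡⇒≈ refl ω = refl

  wordGroup : Group 0ℓ 0ℓ
  wordGroup = record { isGroup = isGroup }
    where
    isGroup : IsGroup _≈_ _++_ [] invert
    isGroup = record
      { isMonoid = record
        { isSemigroup = record
          { isMagma = record
            { isEquivalence = record
              { refl = λ ω → refl ; sym = λ p ω → sym (p ω) ; trans = λ p q ω → trans (p ω) (q ω) }
            ; ∙-cong = λ {x} {y} {u} {v} p q ω → begin
                act (x ++ u) ω    ≡⟨ act-++ x u ω ⟩
                act u (act x ω)   ≡⟨ cong (act u) (p ω) ⟩
                act u (act y ω)   ≡⟨ q (act y ω) ⟩
                act v (act y ω)   ≡⟨ act-++ y v ω ⟨
                act (y ++ v) ω    ∎
            }
          ; assoc = λ x y z → ≡⇒≈ (++-assoc x y z)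
          }
        ; identity = (λ x ω → refl) , (λ x → ≡⇒≈ (++-identityʳ x))
        }
      ; inverse = (λ x ω → trans (act-++ (invert x) x ω) (act-invertʳ x ω))
                , (λ x ω → trans (act-++ x (invert x) ω) (act-invertˡ x ω))
      ; ⁻¹-cong = λ {x} {y} p ω → begin
          act (invert x) ω                                   ≡⟨ cong (act (invert x)) (act-invertʳ y ω) ⟨
          act (invert x) (act y (act (invert y) ω))          ≡⟨ cong (act (invert x)) (p _) ⟨
          act (invert x) (act x (act (invert y) ω))          ≡⟨ act-invertˡ x _ ⟩
          act (invert y) ω                                   ∎
      }
      where open ≡-Reasoning

  open GroupNotions wordGroup

  Reachable : Ω → Ω → Set
  Reachable ω ω′ = ∃ λ w → act w ω ≡ ω′

  reachable-trans : ∀ {ω₁ ω₂ ω₃} → Reachable ω₁ ω₂ → Reachable ω₂ ω₃ → Reachable ω₁ ω₃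
  reachable-trans {ω₁} (v , e) (w , e′) = v ++ w , trans (act-++ v w ω₁) (trans (cong (act w) e) e′)

  module Stabiliser (ω₀ : Ω) where

    Stab : List L → Set
    Stab w = act w ω₀ ≡ ω₀

    stab-isSubgroup : IsSubgroup Stab
    stab-isSubgroup = record
      { resp = λ p u → trans (sym (p ω₀)) u
      ; ε∈  = refl
      ; ∙∈  = λ {x} {y} u v → trans (act-++ x y ω₀) (trans (cong (act y) u) v)
      ; ⁻¹∈ = λ {x} u → trans (cong (act (invert x)) (sym u)) (act-invertˡ x ω₀)
      }

    -- If every conjugate of x fixes ω₀, then x fixes every point of the orbit of ω₀.
    stab-coreFree : (∀ ω → Reachable ω₀ ω) → CoreFree Stab
    stab-coreFree transitive x conj ω = begin
        act x ω                                  ≡⟨ act-invertʳ g (act x ω) ⟨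
        act g (act (invert g) (act x ω))         ≡⟨ cong (λ ω′ → act g (act (invert g) (act x ω′))) e ⟨
        act g (act (invert g) (act x (act g ω₀))) ≡⟨ cong (act g) g⁻¹xg-fixes ⟩
        act g ω₀                                 ≡⟨ e ⟩
        ω                                        ∎
      where
      open ≡-Reasoning
      g = proj₁ (transitive ω)
      e = proj₂ (transitive ω)
      g⁻¹xg-fixes : act (invert g) (act x (act g ω₀)) ≡ ω₀
      g⁻¹xg-fixes = trans (sym (trans (act-++ (g ++ x) (invert g) ω₀)
                                       (cong (act (invert g)) (act-++ g x ω₀))))
                          (conj g)

    module _ (h : List L) where

      sameImage⇒InRC : ∀ {g g′} → act g ω₀ ≡ act g′ ω₀ → InRC Stab h g g′
      sameImage⇒InRC {g} {g′} e = begin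
        act (g′ ++ invert g) ω₀          ≡⟨ act-++ g′ (invert g) ω₀ ⟩
        act (invert g) (act g′ ω₀)       ≡⟨ cong (act (invert g)) e ⟨
        act (invert g) (act g ω₀)        ≡⟨ act-invertˡ g ω₀ ⟩
        ω₀                               ∎
        where open ≡-Reasoning

      InDC⇒orbit : ∀ {g g′} → InDC Stab h g g′ → ∃ λ k → act g′ ω₀ ≡ act (h ^ℤ k) (act g ω₀)
      InDC⇒orbit {g} {g′} (u , k , u-fixes , g′≈ugh) = k , (begin
        act g′ ω₀                        ≡⟨ g′≈ugh ω₀ ⟩
        act ((u ++ g) ++ h ^ℤ k) ω₀      ≡⟨ act-++ (u ++ g) (h ^ℤ k) ω₀ ⟩
        act (h ^ℤ k) (act (u ++ g) ω₀)   ≡⟨ cong (act (h ^ℤ k)) (act-++ u g ω₀) ⟩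
        act (h ^ℤ k) (act g (act u ω₀))  ≡⟨ cong (act (h ^ℤ k) ∘ act g) u-fixes ⟩
        act (h ^ℤ k) (act g ω₀)          ∎)
        where open ≡-Reasoning

      orbit⇒InDC : ∀ {g g′} k → act g′ ω₀ ≡ act (h ^ℤ k) (act g ω₀) → InDC Stab h g g′
      orbit⇒InDC {g} {g′} k e = u , k , u-fixes , g′≈ugh
        where
        open ≡-Reasoning
        hᵏ = h ^ℤ k
        u = (g′ ++ invert hᵏ) ++ invert g
        act-u : ∀ ω → act u ω ≡ act (invert g) (act (invert hᵏ) (act g′ ω))
        act-u ω = trans (act-++ (g′ ++ invert hᵏ) (invert g) ω)
                        (cong (act (invert g)) (act-++ g′ (invert hᵏ) ω))
        u-fixes : Stab u
        u-fixes = begin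
          act u ω₀                                          ≡⟨ act-u ω₀ ⟩
          act (invert g) (act (invert hᵏ) (act g′ ω₀))      ≡⟨ cong (act (invert g) ∘ act (invert hᵏ)) e ⟩
          act (invert g) (act (invert hᵏ) (act hᵏ (act g ω₀))) ≡⟨ cong (act (invert g)) (act-invertˡ hᵏ _) ⟩
          act (invert g) (act g ω₀)                         ≡⟨ act-invertˡ g ω₀ ⟩
          ω₀                                                ∎
        g′≈ugh : g′ ≈ ((u ++ g) ++ hᵏ)
        g′≈ugh ω = sym (begin
          act ((u ++ g) ++ hᵏ) ω                               ≡⟨ act-++ (u ++ g) hᵏ ω ⟩
          act hᵏ (act (u ++ g) ω)                              ≡⟨ cong (act hᵏ) (act-++ u g ω) ⟩
          act hᵏ (act g (act u ω))                             ≡⟨ cong (act hᵏ ∘ act g) (act-u ω) ⟩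
          act hᵏ (act g (act (invert g) (act (invert hᵏ) (act g′ ω)))) ≡⟨ cong (act hᵏ) (act-invertʳ g _) ⟩
          act hᵏ (act (invert hᵏ) (act g′ ω))                  ≡⟨ act-invertʳ hᵏ _ ⟩
          act g′ ω                                             ∎)

module Darts {n : ℕ} (Γ : SimpleGraph n) where
  open SimpleGraph Γ

  degree : Fin n → ℕ
  degree x = count (Adj x)

  Dart : Set
  Dart = Σ (Fin n) λ x → Fin (degree x)

  origin target : Dart → Fin n
  origin = proj₁
  target (x , i) = select (Adj x) i

  adjacent : ∀ ω → Adj (origin ω) (target ω) ≡ true
  adjacent (x , i) = select-true (Adj x) i

  target≢origin : ∀ ω → ¬ target ω ≡ origin ω
  target≢origin ω e with trans (sym (loopless (origin ω))) (trans (cong (Adj (origin ω)) (sym e)) (adjacent ω))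
  ... | ()

  dartTo : ∀ {x y} → Adj x y ≡ true → Dart
  dartTo {x} {y} adj = x , index (Adj x) y adj

  target-dartTo : ∀ {x y} (adj : Adj x y ≡ true) → target (dartTo adj) ≡ y
  target-dartTo {x} {y} = select-index (Adj x) y

  dartTo-unique : ∀ {x y} (adj : Adj x y ≡ true) ω → origin ω ≡ x → target ω ≡ y → ω ≡ dartTo adj
  dartTo-unique {y = y} adj (x , i) refl e = cong (x ,_) (sym (index-select (Adj x) i y adj e))

  reverse : Dart → Dart
  reverse ω = dartTo (trans (symmetric (target ω) (origin ω)) (adjacent ω))

  reverse-involutive : ∀ ω → reverse (reverse ω) ≡ ω
  reverse-involutive ω = sym (dartTo-unique _ ω (sym (target-dartTo _)) refl)

  data Letter : Set where
    rot rot⁻¹ rev : Letter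

  ⟦_⟧ : Letter → Dart → Dart
  ⟦ rot   ⟧ (x , i) = x , rotate i
  ⟦ rot⁻¹ ⟧ (x , i) = x , rotate⁻¹ i
  ⟦ rev   ⟧ ω       = reverse ω

  _⁻ : Letter → Letter
  rot   ⁻ = rot⁻¹
  rot⁻¹ ⁻ = rot
  rev   ⁻ = rev

  ⟦⁻⟧∘⟦⟧ : ∀ a ω → ⟦ a ⁻ ⟧ (⟦ a ⟧ ω) ≡ ω
  ⟦⁻⟧∘⟦⟧ rot   (x , i) = cong (x ,_) (rotate⁻¹-rotate i)
  ⟦⁻⟧∘⟦⟧ rot⁻¹ (x , i) = cong (x ,_) (rotate-rotate⁻¹ i)
  ⟦⁻⟧∘⟦⟧ rev   ω       = reverse-involutive ω

  ⟦⟧∘⟦⁻⟧ : ∀ a ω → ⟦ a ⟧ (⟦ a ⁻ ⟧ ω) ≡ ω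
  ⟦⟧∘⟦⁻⟧ rot   = ⟦⁻⟧∘⟦⟧ rot⁻¹
  ⟦⟧∘⟦⁻⟧ rot⁻¹ = ⟦⁻⟧∘⟦⟧ rot
  ⟦⟧∘⟦⁻⟧ rev   = ⟦⁻⟧∘⟦⟧ rev

  open WordAction ⟦_⟧ _⁻ ⟦⁻⟧∘⟦⟧ ⟦⟧∘⟦⁻⟧ public
  open GroupNotions wordGroup

  ρ τ : List Letter
  ρ = [ rot ]
  τ = [ rev ]

  generates : Generates ρ τ
  generates w = inGen-++ w gen-ε
    where
    inGen-∷ʳ : ∀ a {g} → InGen ρ τ g → InGen ρ τ (g ++ [ a ])
    inGen-∷ʳ rot   = gen-ρ
    inGen-∷ʳ rot⁻¹ = gen-ρ⁻¹
    inGen-∷ʳ rev   = gen-τ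
    inGen-++ : ∀ w {g} → InGen ρ τ g → InGen ρ τ (g ++ w)
    inGen-++ []      {g} ig = gen-≈ (≡⇒≈ (sym (++-identityʳ g))) ig
    inGen-++ (a ∷ w) {g} ig = gen-≈ (≡⇒≈ (++-assoc g [ a ] w)) (inGen-++ w (inGen-∷ʳ a ig))

  τ-involution : (τ ++ τ) ≈ []
  τ-involution = reverse-involutive

  act-ρ^ℕ : ∀ k x i → act (ρ ^ℕ k) (x , i) ≡ (x , iterate rotate i k)
  act-ρ^ℕ zero    x i = refl
  act-ρ^ℕ (suc k) x i = act-ρ^ℕ k x (rotate i)

  origin-act-ρ^ℕ : ∀ k ω → origin (act (ρ ^ℕ k) ω) ≡ origin ω
  origin-act-ρ^ℕ k (x , i) = cong origin (act-ρ^ℕ k x i)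

  origin-act-ρ^ℤ : ∀ k ω → origin (act (ρ ^ℤ k) ω) ≡ origin ω
  origin-act-ρ^ℤ (+ k)    = origin-act-ρ^ℕ k
  origin-act-ρ^ℤ -[1+ k ] = act-invert-invariant origin (ρ ^ℕ suc k) (origin-act-ρ^ℕ (suc k))

  sameOrigin⇒ρ-orbit : ∀ {ω ω′} → origin ω ≡ origin ω′ → ∃ λ k → act (ρ ^ℕ k) ω ≡ ω′
  sameOrigin⇒ρ-orbit {x , i} {.x , j} refl with iterate-rotate-reaches i j
  ... | k , e = k , trans (act-ρ^ℕ k x i) (cong (x ,_) e)

  walk⇒reachable : ∀ {x y} → Walk Γ x y → ∀ ω (j : Fin (degree y)) → origin ω ≡ x → Reachable ω (y , j)
  walk⇒reachable nil ω j refl with sameOrigin⇒ρ-orbit {ω} {origin ω , j} refl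
  ... | k , e = ρ ^ℕ k , e
  walk⇒reachable (cons adj walk) ω j refl with sameOrigin⇒ρ-orbit {ω} {dartTo adj} refl
  ... | k , e = reachable-trans (ρ ^ℕ k ++ τ , trans (act-++ (ρ ^ℕ k) τ ω) (cong reverse e))
                                (walk⇒reachable walk (reverse (dartTo adj)) j (target-dartTo adj))

  transitive : Connected Γ → ∀ ω ω′ → Reachable ω ω′
  transitive connected ω (y , j) = walk⇒reachable (connected (origin ω) y) ω j refl

  module Realisation (connected : Connected Γ) (x₀ : Fin n)
                     (neighbour : ∀ x → ∃ λ y → Adj x y ≡ true) where

    base : Fin n → Dart
    base x = dartTo (proj₂ (neighbour x))

    ω₀ : Dart
    ω₀ = base x₀

    open Stabiliser ω₀

    InDC⇒sameOrigin : ∀ {g g′} → InDC Stab ρ g g′ → origin (act g′ ω₀) ≡ origin (act g ω₀)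
    InDC⇒sameOrigin {g} {g′} d with InDC⇒orbit ρ {g} {g′} d
    ... | k , e = trans (cong origin e) (origin-act-ρ^ℤ k (act g ω₀))

    sameOrigin⇒InDC : ∀ {g g′} → origin (act g′ ω₀) ≡ origin (act g ω₀) → InDC Stab ρ g g′
    sameOrigin⇒InDC {g} {g′} e with sameOrigin⇒ρ-orbit (sym e)
    ... | k , e′ = orbit⇒InDC ρ {g} {g′} (+ k) (sym e′)

    φ : Fin n → List Letter
    φ x = proj₁ (transitive connected ω₀ (base x))

    origin-φ : ∀ x → origin (act (φ x) ω₀) ≡ x
    origin-φ x = cong origin (proj₂ (transitive connected ω₀ (base x)))

    InDC-φ⇒origin : ∀ x g → InDC Stab ρ (φ x) g → origin (act g ω₀) ≡ x
    InDC-φ⇒origin x g d = trans (InDC⇒sameOrigin {φ x} {g} d) (origin-φ x)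

    origin⇒InDC-φ : ∀ x g → origin (act g ω₀) ≡ x → InDC Stab ρ (φ x) g
    origin⇒InDC-φ x g e = sameOrigin⇒InDC {φ x} {g} (trans e (sym (origin-φ x)))

    origin-act-τ : ∀ g → origin (act (g ++ τ) ω₀) ≡ target (act g ω₀)
    origin-act-τ g = cong origin (act-++ g τ ω₀)

    EdgeWord : Fin n → Fin n → List Letter → Set
    EdgeWord x y g = InDC Stab ρ (φ x) g × InDC Stab ρ (φ y) (g ++ τ)

    edgeWord⇒dart : ∀ {x y} g → EdgeWord x y g → origin (act g ω₀) ≡ x × target (act g ω₀) ≡ y
    edgeWord⇒dart {x} {y} g (dx , dy) =
      InDC-φ⇒origin x g dx , trans (sym (origin-act-τ g)) (InDC-φ⇒origin y (g ++ τ) dy)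

    no-loop : ∀ g → ¬ InDC Stab ρ g (g ++ τ)
    no-loop g d = target≢origin (act g ω₀) (trans (sym (origin-act-τ g)) (InDC⇒sameOrigin {g} {g ++ τ} d))

    edge-multiplicity-one : ∀ {x y} → Adj x y ≡ true → EdgeMultiplicity Stab ρ τ (φ x) (φ y) 1
    edge-multiplicity-one {x} {y} adj = (λ _ → w) , (λ _ → w-edge) , (λ { zero zero _ → refl }) , covers
      where
      w = proj₁ (transitive connected ω₀ (dartTo adj))
      act-w : act w ω₀ ≡ dartTo adj
      act-w = proj₂ (transitive connected ω₀ (dartTo adj))
      w-edge : EdgeWord x y w
      w-edge = origin⇒InDC-φ x w (cong origin act-w)
             , origin⇒InDC-φ y (w ++ τ)
                     (trans (origin-act-τ w) (trans (cong target act-w) (target-dartTo adj)))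
      covers : ∀ g → EdgeWord x y g → Σ (Fin 1) λ _ → InRC Stab ρ w g
      covers g edge with edgeWord⇒dart g edge
      ... | ox , ty = zero , sameImage⇒InRC ρ {w} {g} (trans act-w (sym (dartTo-unique adj (act g ω₀) ox ty)))

    edge-multiplicity-zero : ∀ {x y} → Adj x y ≡ false → EdgeMultiplicity Stab ρ τ (φ x) (φ y) 0
    edge-multiplicity-zero {x} {y} nonadj = (λ ()) , (λ ()) , (λ ()) , λ g edge → ⊥-elim (excluded g edge)
      where
      excluded : ∀ g → ¬ EdgeWord x y g
      excluded g edge with edgeWord⇒dart g edge
      ... | ox , ty with trans (sym nonadj) (trans (sym (cong₂ Adj ox ty)) (adjacent (act g ω₀)))
      ... | ()

    iso : MonIso Γ Stab ρ τ
    iso = record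
      { φ                    = φ
      ; φ-onto               = λ g → origin (act g ω₀) , origin⇒InDC-φ _ g refl
      ; φ-injective          = λ x y d → trans (sym (InDC-φ⇒origin x (φ y) d)) (origin-φ y)
      ; no-free-edge-or-loop = no-loop
      ; edges-adj            = λ _ _ _ → edge-multiplicity-one
      ; edges-nonadj         = λ _ _ _ → edge-multiplicity-zero
      }

    monodromyRealisation : MonodromyRealisation Γ
    monodromyRealisation = record
      { G            = wordGroup
      ; ρ            = ρ
      ; τ            = τ
      ; U            = Stab
      ; generates    = generates
      ; τ-involution = τ-involution
      ; U-subgroup   = stab-isSubgroup
      ; U-corefree   = stab-coreFree (transitive connected ω₀)
      ; iso          = iso
      }

walk-firstStep : ∀ {n} (Γ : SimpleGraph n) {x y} → Walk Γ x y → ¬ x ≡ y →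
                 ∃ λ z → SimpleGraph.Adj Γ x z ≡ true
walk-firstStep Γ nil                  x≢x = ⊥-elim (x≢x refl)
walk-firstStep Γ (cons {y = z} adj _) _   = z , adj

connected⇒hasNeighbour : ∀ {m} (Γ : SimpleGraph (suc (suc m))) → Connected Γ →
                         ∀ x → ∃ λ y → SimpleGraph.Adj Γ x y ≡ true
connected⇒hasNeighbour Γ connected zero    = walk-firstStep Γ (connected zero (suc zero)) λ ()
connected⇒hasNeighbour Γ connected (suc x) = walk-firstStep Γ (connected (suc x) zero) λ ()

corollary3p8 : ∀ (n : ℕ) (Γ : SimpleGraph n) → 1 < n → Connected Γ →
                 MonodromyRealisation Γ
corollary3p8 (suc (suc m)) Γ (s≤s (s≤s _)) connected =
  Darts.Realisation.monodromyRealisation Γ connected zero (connected⇒hasNeighbour Γ connected)
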